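{- For every BPL-model $\mathfrak{M}$ and all $\mathcal{L}_{\mathrm{BPL}}$-formulas $A,B$: if the sequent $A\Rightarrow B$ is derivable in $\mathsf{S^*_{RBL}}$, then for every state $x$ of $\mathfrak{J}^{\mathfrak{M}}$, $\mathfrak{J}^{\mathfrak{M}},x\models A$ implies $\mathfrak{J}^{\mathfrak{M}},x\models B$.
   Context: $\mathcal{L}_{\mathrm{BPL}}$-formulas are built from propositional letters and $\bot,\top$ by $\wedge,\vee,\rightarrow$; $\mathcal{L}_{\mathrm{RBL}}$-formulas additionally use the binary connectives $\cdot$ and $\leftarrow$. A BPL-model is $\mathfrak{M}=(W,R,V)$ with $W$ nonempty, $R\subseteq W^2$ transitive, and $V$ assigning to each propositional letter a subset of $W$ such that $w\in V(p)$ and $wRu$ imply $u\in V(p)$; satisfaction is standard with $\mathfrak{M},w\models A\rightarrow B$ iff for all $v$ with $wRv$, $\mathfrak{M},v\models A$ implies $\mathfrak{M},v\models B$. A ternary model is $\mathfrak{J}=(W',R',V')$ with $R'\subseteq W'^3$; satisfaction: $p$ via $V'$; $\top$ always, $\bot$ never; $\wedge,\vee$ pointwise; $a\models A\cdot B$ iff there are $x,y$ with $R'(a,x,y)$, $x\models A$, $y\models B$; $a\models A\leftarrow B$ iff for all $x,y$ with $R'(x,a,y)$, $y\models B$ implies $x\models A$; $a\models A\rightarrow B$ iff for all $x,y$ with $R'(x,y,a)$, $y\models A$ implies $x\models B$. Given $\mathfrak{M}=(W,R,V)$, $\mathfrak{J}^{\mathfrak{M}}=(W',R',V')$ has $W'=\{a_1,a_2: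 a\in W\}$ (two distinct copies of each state), $R'=\{(b_1,b_2,a_1),(b_2,b_1,a_1),(b_1,b_2,a_2),(b_2,b_1,a_2): aRb\}$, $V'(p)=\{a_i: i\in\{1,2\}, a\in V(p)\}$. The system $\mathsf{S^*_{RBL}}$ derives sequents $A\Rightarrow B$ between $\mathcal{L}_{\mathrm{RBL}}$-formulas from the axioms $A\Rightarrow A$; $\bot\Rightarrow A$; $A\Rightarrow\top$; $A\wedge(B\vee C)\Rightarrow(A\wedge B)\vee(A\wedge C)$; $\top\Rightarrow A\rightarrow A$; $A\Rightarrow\top\rightarrow A$; $(A\rightarrow B)\wedge(B\rightarrow C)\Rightarrow A\rightarrow C$; using the rules: Cut (from $A\Rightarrow B$ and $B\Rightarrow C$ infer $A\Rightarrow C$); from $A\cdot B\Rightarrow C$ infer $B\Rightarrow A\rightarrow C$ and conversely; from $A\cdot B\Rightarrow C$ infer $A\Rightarrow C\leftarrow B$ and conversely; from $A_i\Rightarrow B$ infer $A_1\wedge A_2\Rightarrow B$; from $C\Rightarrow A$ and $C\Rightarrow B$ infer $C\Rightarrow A\wedge B$; from $A\Rightarrow C$ and $B\Rightarrow C$ infer $A\vee B\Rightarrow C$; from $C\Rightarrow A_i$ infer $C\Rightarrow A_1\vee A_2$ ($i=1,2$). -}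

module Defs where

open import Data.Nat using (ℕ)
open import Data.Bool using (Bool; true; false)
open import Data.Product using (_×_; _,_; Σ; ∃-syntax)
open import Data.Sum using (_⊎_)
open import Data.Unit using (⊤)
open import Data.Empty using (⊥)
open import Relation.Binary.PropositionalEquality using (_≡_)

infixr 6 _∧_
infixr 5 _∨_
infixr 4 _⇒_
data Form : Set where
  var   : ℕ → Form
  ⊥f ⊤f : Form
  _∧_ _∨_ _⇒_ : Form → Form → Form
  _·_ _⇐_ : Form → Form → Form

data IsBPL : Form → Set where
  var : ∀ n → IsBPL (var n)
  bot : IsBPL ⊥f
  top : IsBPL ⊤f
  and : ∀ {A B} → IsBPL A → IsBPL B → IsBPL (A ∧ B)
  or  : ∀ {A B} → IsBPL A → IsBPL B → IsBPL (A ∨ B)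
  imp : ∀ {A B} → IsBPL A → IsBPL B → IsBPL (A ⇒ B)

infix 2 _⊢_
data _⊢_ : Form → Form → Set where
  ax-id   : ∀ {A} → A ⊢ A
  ax-bot  : ∀ {A} → ⊥f ⊢ A
  ax-top  : ∀ {A} → A ⊢ ⊤f
  ax-dist : ∀ {A B C} → A ∧ (B ∨ C) ⊢ (A ∧ B) ∨ (A ∧ C)
  ax-refl : ∀ {A} → ⊤f ⊢ A ⇒ A
  ax-topi : ∀ {A} → A ⊢ ⊤f ⇒ A
  ax-tran : ∀ {A B C} → (A ⇒ B) ∧ (B ⇒ C) ⊢ A ⇒ C
  cut     : ∀ {A B C} → A ⊢ B → B ⊢ C → A ⊢ C
  res⇒    : ∀ {A B C} → A · B ⊢ C → B ⊢ A ⇒ C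
  res⇒⁻   : ∀ {A B C} → B ⊢ A ⇒ C → A · B ⊢ C
  res⇐    : ∀ {A B C} → A · B ⊢ C → A ⊢ C ⇐ B
  res⇐⁻   : ∀ {A B C} → A ⊢ C ⇐ B → A · B ⊢ C
  ∧L₁     : ∀ {A₁ A₂ B} → A₁ ⊢ B → A₁ ∧ A₂ ⊢ B
  ∧L₂     : ∀ {A₁ A₂ B} → A₂ ⊢ B → A₁ ∧ A₂ ⊢ B
  ∧R      : ∀ {A B C} → C ⊢ A → C ⊢ B → C ⊢ A ∧ B
  ∨L      : ∀ {A B C} → A ⊢ C → B ⊢ C → A ∨ B ⊢ C
  ∨R₁     : ∀ {A₁ A₂ C} → C ⊢ A₁ → C ⊢ A₁ ∨ A₂
  ∨R₂     : ∀ {A₁ A₂ C} → C ⊢ A₂ → C ⊢ A₁ ∨ A₂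

record BPLModel : Set₁ where
  field
    W     : Set
    w₀    : W
    R     : W → W → Set
    trans : ∀ {a b c} → R a b → R b c → R a c
    V     : ℕ → W → Set
    mono  : ∀ {p w u} → V p w → R w u → V p u

record TernaryModel : Set₁ where
  field
    W' : Set
    R' : W' → W' → W' → Set
    V' : ℕ → W' → Set

module _ (𝔍 : TernaryModel) where
  open TernaryModel 𝔍
  infix 3 _⊨_
  _⊨_ : W' → Form → Set
  a ⊨ var p  = V' p a
  a ⊨ ⊥f     = ⊥
  a ⊨ ⊤f     = ⊤
  a ⊨ A ∧ B  = (a ⊨ A) × (a ⊨ B)
  a ⊨ A ∨ B  = (a ⊨ A) ⊎ (a ⊨ B)
  a ⊨ A · B  = ∃[ x ] ∃[ y ] (R' a x y × (x ⊨ A) × (y ⊨ B))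
  a ⊨ A ⇐ B  = ∀ x y → R' x a y → y ⊨ B → x ⊨ A
  a ⊨ A ⇒ B  = ∀ x y → R' x y a → y ⊨ A → x ⊨ B

-- The ternary model J^M: states (a , i) stand for a_1 (i = true), a_2 (i = false).
-- R' = {(b_i, b_j, a_k) : aRb, i ≠ j}.
𝔍 : BPLModel → TernaryModel
𝔍 M = record
  { W' = W × Bool
  ; R' = λ { (b , i) (b' , j) (a , k) → R a b × (b ≡ b') × (i ≡ not' j) }
  ; V' = λ { p (a , i) → V p a }
  }
  where
    open BPLModel M
    not' : Bool → Bool
    not' true = false
    not' false = true

-- On BPL formulas, truth in J^M at either copy a₁, a₂ coincides with
-- BPL-forcing at a.  So it suffices to extend forcing persistently to all of
-- L_RBL in M itself in such a way that S*_RBL is sound; a derivation A ⊢ B is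
-- then transported from J^M to M and back.
module Submission where

open import Defs
open import Data.Bool using (true; false)
open import Data.Product using (_×_; _,_; ∃-syntax)
open import Data.Sum using (_⊎_; inj₁; inj₂)
open import Data.Unit using (⊤; tt)
open import Data.Empty using (⊥)
open import Relation.Binary.PropositionalEquality using (refl)
open import Relation.Binary.Construct.Closure.Reflexive using (ReflClosure; [_])
  renaming (refl to ε)

module Forcing (M : BPLModel) where
  open BPLModel M

  -- A · B and C ⇐ B are read as in J^M with the two copies of a state
  -- identified; C ⇐ B ranges over reflexive successors to stay persistent.
  infix 3 _⊩_
  _⊩_ : W → Form → Set
  w ⊩ var p = V p w
  w ⊩ ⊥f    = ⊥
  w ⊩ ⊤f    = ⊤
  w ⊩ A ∧ B = (w ⊩ A) × (w ⊩ B)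
  w ⊩ A ∨ B = (w ⊩ A) ⊎ (w ⊩ B)
  w ⊩ A ⇒ B = ∀ v → R w v → v ⊩ A → v ⊩ B
  w ⊩ A · B = (w ⊩ A) × ∃[ b ] (R b w × b ⊩ B)
  w ⊩ C ⇐ B = ∀ c → ReflClosure R w c → ∃[ b ] (R b c × b ⊩ B) → c ⊩ C

  ⊩-mono : ∀ A {w u} → w ⊩ A → R w u → u ⊩ A
  ⊩-mono (var p) w⊩p      wRu = mono w⊩p wRu
  ⊩-mono ⊤f      _        _   = tt
  ⊩-mono (A ∧ B) (a , b)  wRu = ⊩-mono A a wRu , ⊩-mono B b wRu
  ⊩-mono (A ∨ B) (inj₁ a) wRu = inj₁ (⊩-mono A a wRu)
  ⊩-mono (A ∨ B) (inj₂ b) wRu = inj₂ (⊩-mono B b wRu)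
  ⊩-mono (A ⇒ B) f        wRu = λ v uRv → f v (trans wRu uRv)
  ⊩-mono (A · B) (a , b , bRw , b⊩B) wRu = ⊩-mono A a wRu , b , trans bRw wRu , b⊩B
  ⊩-mono (C ⇐ B) f wRu c ε       = f c [ wRu ]
  ⊩-mono (C ⇐ B) f wRu c [ uRc ] = f c [ trans wRu uRc ]

  ⊩-sound : ∀ {A B} → A ⊢ B → ∀ w → w ⊩ A → w ⊩ B
  ⊩-sound ax-id          w a               = a
  ⊩-sound ax-top         w _               = tt
  ⊩-sound ax-dist        w (a , inj₁ b)    = inj₁ (a , b)
  ⊩-sound ax-dist        w (a , inj₂ c)    = inj₂ (a , c)
  ⊩-sound ax-refl        w _               = λ v _ a → a
  ⊩-sound (ax-topi {A})  w a               = λ v wRv _ → ⊩-mono A a wRv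
  ⊩-sound ax-tran        w (f , g)         = λ v wRv a → g v wRv (f v wRv a)
  ⊩-sound (cut d e)      w a               = ⊩-sound e w (⊩-sound d w a)
  ⊩-sound (res⇒ d)       w b               = λ v wRv a → ⊩-sound d v (a , w , wRv , b)
  ⊩-sound (res⇒⁻ d)      w (a , b , bRw , b⊩B) = ⊩-sound d b b⊩B w bRw a
  ⊩-sound (res⇐ d)       w a c ε (b , bRc , b⊩B) = ⊩-sound d c (a , b , bRc , b⊩B)
  ⊩-sound (res⇐ {A} d)   w a c [ wRc ] (b , bRc , b⊩B) =
    ⊩-sound d c (⊩-mono A a wRc , b , bRc , b⊩B)
  ⊩-sound (res⇐⁻ d)      w (a , pred) = ⊩-sound d w a w ε pred
  ⊩-sound (∧L₁ d)        w (a , _)         = ⊩-sound d w a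
  ⊩-sound (∧L₂ d)        w (_ , b)         = ⊩-sound d w b
  ⊩-sound (∧R d e)       w c               = ⊩-sound d w c , ⊩-sound e w c
  ⊩-sound (∨L d e)       w (inj₁ a)        = ⊩-sound d w a
  ⊩-sound (∨L d e)       w (inj₂ b)        = ⊩-sound e w b
  ⊩-sound (∨R₁ d)        w c               = inj₁ (⊩-sound d w c)
  ⊩-sound (∨R₂ d)        w c               = inj₂ (⊩-sound d w c)

  open TernaryModel (𝔍 M) using (R')

  infix 3 _⊨ᴶ_
  _⊨ᴶ_ : TernaryModel.W' (𝔍 M) → Form → Set
  _⊨ᴶ_ = _⊨_ (𝔍 M)

  ⊨ᴶ⇒⊩ : ∀ {A} → IsBPL A → ∀ a i → (a , i) ⊨ᴶ A → a ⊩ A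
  ⊩⇒⊨ᴶ : ∀ {A} → IsBPL A → ∀ a i → a ⊩ A → (a , i) ⊨ᴶ A

  ⊨ᴶ⇒⊩ (var n)   a i a⊨p      = a⊨p
  ⊨ᴶ⇒⊩ top       a i _        = tt
  ⊨ᴶ⇒⊩ (and p q) a i (s , t)  = ⊨ᴶ⇒⊩ p a i s , ⊨ᴶ⇒⊩ q a i t
  ⊨ᴶ⇒⊩ (or p q)  a i (inj₁ s) = inj₁ (⊨ᴶ⇒⊩ p a i s)
  ⊨ᴶ⇒⊩ (or p q)  a i (inj₂ t) = inj₂ (⊨ᴶ⇒⊩ q a i t)
  ⊨ᴶ⇒⊩ (imp p q) a i f v aRv v⊩A =
    ⊨ᴶ⇒⊩ q v false (f (v , false) (v , true) (aRv , refl , refl) (⊩⇒⊨ᴶ p v true v⊩A))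

  ⊩⇒⊨ᴶ (var n)   a i a⊩p      = a⊩p
  ⊩⇒⊨ᴶ top       a i _        = tt
  ⊩⇒⊨ᴶ (and p q) a i (s , t)  = ⊩⇒⊨ᴶ p a i s , ⊩⇒⊨ᴶ q a i t
  ⊩⇒⊨ᴶ (or p q)  a i (inj₁ s) = inj₁ (⊩⇒⊨ᴶ p a i s)
  ⊩⇒⊨ᴶ (or p q)  a i (inj₂ t) = inj₂ (⊩⇒⊨ᴶ q a i t)
  ⊩⇒⊨ᴶ (imp {A} {B} p q) a i f = ⊨ᴶ-imp
    where
      ⊨ᴶ-imp : ∀ x y → R' x y (a , i) → y ⊨ᴶ A → x ⊨ᴶ B
      ⊨ᴶ-imp (b , i′) (.b , j) (aRb , refl , _) y⊨A =
        ⊩⇒⊨ᴶ q b i′ (f b aRb (⊨ᴶ⇒⊩ p b j y⊨A))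

lemma2 : (M : BPLModel) (A B : Form) → IsBPL A → IsBPL B → A ⊢ B →
    (x : TernaryModel.W' (𝔍 M)) → _⊨_ (𝔍 M) x A → _⊨_ (𝔍 M) x B
lemma2 M A B bplA bplB A⊢B (a , i) x⊨A =
  ⊩⇒⊨ᴶ bplB a i (⊩-sound A⊢B a (⊨ᴶ⇒⊩ bplA a i x⊨A))
  where open Forcing M
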